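{- Let $\sigma$ be a P-optimal swap sequence for a token swapping instance on a broom. Then: (1) no swap in $\sigma$ on a path edge exchanges two star tokens; (2) in every swap of $\sigma$ on a path edge that involves a path token, the larger of the two tokens moves to the right; (3) no token crosses the first path edge $(v_{k+1},v_{k+2})$ from left to right and later from right to left (in particular no star token crosses it from left to right); (4) the path tokens that cross the first path edge from left to right do so in decreasing order of their labels.
   Context: A broom consists of star leaves $v_1,\dots,v_k$, each adjacent to the center vertex $v_{k+1}$, and a path $v_{k+1},v_{k+2},\dots,v_n$ (edges $v_iv_{i+1}$ for $k+1\le i<n$, called path edges; the edges $v_iv_{k+1}$, $i\le k$, are star edges). "Right" means toward higher indices. Tokens $1,\dots,n$ are placed one per vertex; a swap exchanges the tokens on the endpoints of an edge; the goal is to bring token $i$ to $v_i$ for all $i$. Tokens $1,\dots,k$ are star tokens, tokens $k+1,\dots,n$ are path tokens. A swap sequence is optimal if it sorts the tokens with the minimum number of swaps, and P-optimal if it is optimal and, among optimal swap sequences, has the minimum number of swaps on path edges. -}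

module Defs where

open import Data.Nat using (ℕ; zero; suc; _<_; _≤_; _+_)
open import Data.Fin using (Fin; toℕ; _≟_)
open import Data.List using (List; []; _∷_; length; take; lookup; filter)
open import Data.Sum using (_⊎_)
open import Data.Product using (_×_; Σ; ∃; _,_)
open import Data.Empty using (⊥)
open import Relation.Nullary using (¬_; yes; no; Dec)
open import Relation.Binary.PropositionalEquality using (_≡_)
open import Function.Definitions using (Injective)

-- Broom with n vertices and k star leaves.  Vertex v_{i+1} of the paper is
-- represented by (x : Fin n) with toℕ x = i (0-based).  Thus the star leaves
-- are the x with toℕ x < k, the center v_{k+1} is toℕ x = k, and the path is
-- toℕ x ≥ k.  Token i+1 is likewise represented by (t : Fin n) with toℕ t = i,
-- and its target vertex is the x with x = t.

module Broom (k n : ℕ) where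

  Vertex : Set
  Vertex = Fin n

  Token : Set
  Token = Fin n

  StarEdge : Vertex → Vertex → Set
  StarEdge a b = (toℕ a < k) × (toℕ b ≡ k)

  PathEdge : Vertex → Vertex → Set
  PathEdge a b = (k ≤ toℕ a) × (toℕ b ≡ suc (toℕ a))

  record Swap : Set where
    constructor swap
    field
      left  : Vertex
      right : Vertex
      isEdge : StarEdge left right ⊎ PathEdge left right
  open Swap public

  IsPathSwap : Swap → Set
  IsPathSwap s = PathEdge (left s) (right s)

  isPathSwap? : (s : Swap) → Dec (IsPathSwap s)
  isPathSwap? s with k Data.Nat.≤? toℕ (left s) | toℕ (right s) Data.Nat.≟ suc (toℕ (left s))
  ... | yes p | yes q = yes (p , q)
  ... | no ¬p | _ = no λ { (p , _) → ¬p p }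
  ... | yes _ | no ¬q = no λ { (_ , q) → ¬q q }

  Config : Set
  Config = Vertex → Token

  applySwap : Swap → Config → Config
  applySwap s f x with x ≟ left s | x ≟ right s
  ... | yes _ | _     = f (right s)
  ... | no _  | yes _ = f (left s)
  ... | no _  | no _  = f x

  run : List Swap → Config → Config
  run []      f = f
  run (s ∷ σ) f = run σ (applySwap s f)

  Sorts : List Swap → Config → Set
  Sorts σ f = ∀ x → run σ f x ≡ x

  Optimal : List Swap → Config → Set
  Optimal σ f = Sorts σ f × (∀ τ → Sorts τ f → length σ ≤ length τ)

  pathSwaps : List Swap → ℕ
  pathSwaps σ = length (filter isPathSwap? σ)

  POptimal : List Swap → Config → Set
  POptimal σ f = Optimal σ f × (∀ τ → Optimal τ f → pathSwaps σ ≤ pathSwaps τ)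

  StarToken PathToken : Token → Set
  StarToken t = toℕ t < k
  PathToken t = k ≤ toℕ t

  -- Configuration just before the i-th swap of σ (0-based).
  before : (σ : List Swap) → Config → Fin (length σ) → Config
  before σ f i = run (take (toℕ i) σ) f

  OnFirstPathEdge : Swap → Set
  OnFirstPathEdge s = IsPathSwap s × (toℕ (left s) ≡ k)

  CrossLR : (σ : List Swap) → Config → Token → Fin (length σ) → Set
  CrossLR σ f t i = OnFirstPathEdge (lookup σ i) × (before σ f i (left (lookup σ i)) ≡ t)

  CrossRL : (σ : List Swap) → Config → Token → Fin (length σ) → Set
  CrossRL σ f t i = OnFirstPathEdge (lookup σ i) × (before σ f i (right (lookup σ i)) ≡ t)

module Submission where

-- Rank every token by the depth of its target vertex: all leaves have depth k,
-- the centre k+1, and the path vertices increase to the right.  The heart of the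
-- proof is the key lemma (deeper-moves-right): in a P-optimal σ every path swap
-- moves the token with the deeper target to the right.  Otherwise the two tokens,
-- which end on their own vertices, must regain their depth order later; at the
-- first moment they do, either they are swapped back or they stand on a star
-- edge, and σ could be shortened or could trade a path swap for a star swap.
-- Claims (1), (2) and the star case of (3) follow at once.  For (3) and (4) we
-- show that a token crossing the first path edge from left to right stays right
-- of the centre forever, and that a deeper token reaching the centre after such a
-- crossing must come from a leaf, where exchanging it with the crossing token
-- would again save a path swap.

open import Defs
open import Data.Nat using (ℕ; _<_)
open import Data.Fin using (Fin; toℕ) renaming (_<_ to _<ᶠ_)
open import Data.List using (List; length; lookup)
open import Data.Sum using (_⊎_)
open import Data.Product using (_×_)
open import Relation.Nullary using (¬_)
open import Relation.Binary.PropositionalEquality using (_≢_)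
open import Function.Definitions using (Injective)
open import Relation.Binary.PropositionalEquality using (_≡_)

open import Data.Nat using (suc; _≤_; _⊔_; s≤s)
import Data.Nat.Properties as ℕ
open import Data.Fin using (_≟_) renaming (zero to fzero; suc to fsuc)
open import Data.Fin.Properties using (toℕ-injective)
open import Data.Fin.Permutation.Components using (transpose)
open import Data.List using ([]; _∷_; _++_; take; filter)
open import Data.List.Properties using (length-++-sucʳ; filter-++; filter-accept; filter-reject; ++-assoc)
open import Data.Sum using (inj₁; inj₂)
open import Data.Product using (Σ; _,_; proj₁; proj₂)
open import Data.Empty using (⊥; ⊥-elim)
open import Function using (_∘_)
open import Relation.Nullary using (yes; no)
open import Relation.Binary.PropositionalEquality
  using (refl; sym; trans; cong; cong₂; cong-app; subst; subst₂; module ≡-Reasoning)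
open import Relation.Binary.Definitions using (Tri; tri<; tri≈; tri>)
open ≡-Reasoning

module _ {m : ℕ} where

  transpose-first : (a b : Fin m) → transpose a b a ≡ b
  transpose-first a b with a ≟ a
  ... | yes _   = refl
  ... | no a≢a = ⊥-elim (a≢a refl)

  transpose-second : (a b : Fin m) → b ≢ a → transpose a b b ≡ a
  transpose-second a b b≢a with b ≟ a
  ... | yes b≡a = ⊥-elim (b≢a b≡a)
  ... | no _ with b ≟ b
  ...   | yes _   = refl
  ...   | no b≢b = ⊥-elim (b≢b refl)

  transpose-other : (a b z : Fin m) → z ≢ a → z ≢ b → transpose a b z ≡ z
  transpose-other a b z z≢a z≢b with z ≟ a
  ... | yes z≡a = ⊥-elim (z≢a z≡a)
  ... | no _ with z ≟ b
  ...   | yes z≡b = ⊥-elim (z≢b z≡b)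
  ...   | no _    = refl

module _ {A : Set} where

  record Cut (xs : List A) (i : Fin (length xs)) : Set where
    constructor cutAt
    field
      front : List A
      back  : List A
      whole : xs ≡ front ++ lookup xs i ∷ back
      taken : take (toℕ i) xs ≡ front

  cut : (xs : List A) (i : Fin (length xs)) → Cut xs i
  cut (x ∷ xs) fzero    = cutAt [] xs refl refl
  cut (x ∷ xs) (fsuc i) with cut xs i
  ... | cutAt α ρ whole taken = cutAt (x ∷ α) ρ (cong (x ∷_) whole) (cong (x ∷_) taken)

  record Cut₂ (xs : List A) (i j : Fin (length xs)) : Set where
    constructor cutAt₂
    field
      front  : List A
      middle : List A
      back   : List A
      whole  : xs ≡ front ++ lookup xs i ∷ (middle ++ lookup xs j ∷ back)
      takenᵢ : take (toℕ i) xs ≡ front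
      takenⱼ : take (toℕ j) xs ≡ front ++ lookup xs i ∷ middle

  cut₂ : (xs : List A) (i j : Fin (length xs)) → i <ᶠ j → Cut₂ xs i j
  cut₂ (x ∷ xs) fzero (fsuc j) _ with cut xs j
  ... | cutAt ρ β whole taken = cutAt₂ [] ρ β (cong (x ∷_) whole) refl (cong (x ∷_) taken)
  cut₂ (x ∷ xs) (fsuc i) (fsuc j) (s≤s i<j) with cut₂ xs i j i<j
  ... | cutAt₂ α ρ β whole takenᵢ takenⱼ =
    cutAt₂ (x ∷ α) ρ β (cong (x ∷_) whole) (cong (x ∷_) takenᵢ) (cong (x ∷_) takenⱼ)

module Swaps (k n : ℕ) where
  open Broom k n

  -- Configurations are compared pointwise (there is no function extensionality).
  infix 4 _≐_
  _≐_ : Config → Config → Set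
  c ≐ c′ = ∀ x → c x ≡ c′ x

  Inj : Config → Set
  Inj c = Injective _≡_ _≡_ c

  left<right : ∀ s → toℕ (left s) < toℕ (right s)
  left<right (swap l r (inj₁ (l<k , r≡k))) rewrite r≡k = l<k
  left<right (swap l r (inj₂ (_ , r≡1+l))) rewrite r≡1+l = ℕ.n<1+n _

  left≢right : ∀ s → left s ≢ right s
  left≢right s eq = ℕ.<-irrefl (cong toℕ eq) (left<right s)

  star-not-path : ∀ s → toℕ (left s) < k → ¬ IsPathSwap s
  star-not-path s l<k (k≤l , _) = ℕ.<⇒≱ l<k k≤l

  path-by-left : ∀ s → k ≤ toℕ (left s) → IsPathSwap s
  path-by-left (swap l r (inj₁ (l<k , _))) k≤l = ⊥-elim (ℕ.<⇒≱ l<k k≤l)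
  path-by-left (swap l r (inj₂ pe)) _ = pe

  path-by-right : ∀ s → k < toℕ (right s) → IsPathSwap s
  path-by-right (swap l r (inj₁ (_ , r≡k))) k<r = ⊥-elim (ℕ.<-irrefl (sym r≡k) k<r)
  path-by-right (swap l r (inj₂ pe)) _ = pe

  -- move s v: the partner of v under the swap s (v itself if v is not an endpoint).
  -- It is an involution, so it is both where the token on v goes and where the
  -- token arriving on v comes from.
  move : Swap → Vertex → Vertex
  move s v with v ≟ left s | v ≟ right s
  ... | yes _ | _     = right s
  ... | no _  | yes _ = left s
  ... | no _  | no _  = v

  applySwap-move : ∀ s c v → applySwap s c v ≡ c (move s v)
  applySwap-move s c v with v ≟ left s | v ≟ right s
  ... | yes _ | _     = refl
  ... | no _  | yes _ = refl
  ... | no _  | no _  = refl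

  move-left : ∀ s → move s (left s) ≡ right s
  move-left s with left s ≟ left s
  ... | yes _   = refl
  ... | no l≢l = ⊥-elim (l≢l refl)

  move-right : ∀ s → move s (right s) ≡ left s
  move-right s with right s ≟ left s | right s ≟ right s
  ... | yes r≡l | _     = ⊥-elim (left≢right s (sym r≡l))
  ... | no _    | yes _ = refl
  ... | no _    | no r≢r = ⊥-elim (r≢r refl)

  move-elsewhere : ∀ s v → v ≢ left s → v ≢ right s → move s v ≡ v
  move-elsewhere s v v≢l v≢r with v ≟ left s | v ≟ right s
  ... | yes v≡l | _       = ⊥-elim (v≢l v≡l)
  ... | no _    | yes v≡r = ⊥-elim (v≢r v≡r)
  ... | no _    | no _    = refl

  data MoveCase (s : Swap) (v : Vertex) : Set where
    atLeft    : v ≡ left s → move s v ≡ right s → MoveCase s v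
    atRight   : v ≡ right s → move s v ≡ left s → MoveCase s v
    elsewhere : v ≢ left s → v ≢ right s → move s v ≡ v → MoveCase s v

  moveCase : ∀ s v → MoveCase s v
  moveCase s v with v ≟ left s | v ≟ right s
  ... | yes refl | _        = atLeft refl (move-left s)
  ... | no v≢l   | yes refl = atRight refl (move-right s)
  ... | no v≢l   | no v≢r   = elsewhere v≢l v≢r (move-elsewhere s v v≢l v≢r)

  move-invol : ∀ s v → move s (move s v) ≡ v
  move-invol s v with moveCase s v
  ... | atLeft v≡l m rewrite m = trans (move-right s) (sym v≡l)
  ... | atRight v≡r m rewrite m = trans (move-left s) (sym v≡r)
  ... | elsewhere _ _ m rewrite m = m

  applySwap-invol : ∀ s c → applySwap s (applySwap s c) ≐ c
  applySwap-invol s c v = begin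
    applySwap s (applySwap s c) v ≡⟨ applySwap-move s _ v ⟩
    applySwap s c (move s v)      ≡⟨ applySwap-move s c (move s v) ⟩
    c (move s (move s v))         ≡⟨ cong c (move-invol s v) ⟩
    c v                           ∎

  -- track ρ x: the vertex to which ρ carries the token standing on x;
  -- untrack ρ w: the vertex the token ending on w started from.
  track : List Swap → Vertex → Vertex
  track []      x = x
  track (s ∷ ρ) x = track ρ (move s x)

  untrack : List Swap → Vertex → Vertex
  untrack []      w = w
  untrack (s ∷ ρ) w = move s (untrack ρ w)

  run-untrack : ∀ ρ c w → run ρ c w ≡ c (untrack ρ w)
  run-untrack []      c w = refl
  run-untrack (s ∷ ρ) c w =
    trans (run-untrack ρ (applySwap s c) w) (applySwap-move s c (untrack ρ w))

  untrack-track : ∀ ρ x → untrack ρ (track ρ x) ≡ x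
  untrack-track []      x = refl
  untrack-track (s ∷ ρ) x = trans (cong (move s) (untrack-track ρ (move s x))) (move-invol s x)

  track-untrack : ∀ ρ w → track ρ (untrack ρ w) ≡ w
  track-untrack []      w = refl
  track-untrack (s ∷ ρ) w = trans (cong (track ρ) (move-invol s (untrack ρ w))) (track-untrack ρ w)

  run-track : ∀ ρ c x → run ρ c (track ρ x) ≡ c x
  run-track ρ c x = trans (run-untrack ρ c (track ρ x)) (cong c (untrack-track ρ x))

  track-++ : ∀ ρ ρ′ x → track (ρ ++ ρ′) x ≡ track ρ′ (track ρ x)
  track-++ []      ρ′ x = refl
  track-++ (s ∷ ρ) ρ′ x = track-++ ρ ρ′ (move s x)

  run-++ : ∀ ρ ρ′ c → run (ρ ++ ρ′) c ≡ run ρ′ (run ρ c)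
  run-++ []      ρ′ c = refl
  run-++ (s ∷ ρ) ρ′ c = run-++ ρ ρ′ (applySwap s c)

  run-inj : ∀ ρ c → Inj c → Inj (run ρ c)
  run-inj ρ c c-inj {x} {y} eq = begin
    x                        ≡⟨ sym (track-untrack ρ x) ⟩
    track ρ (untrack ρ x)    ≡⟨ cong (track ρ) (c-inj (begin
      c (untrack ρ x)          ≡⟨ sym (run-untrack ρ c x) ⟩
      run ρ c x                ≡⟨ eq ⟩
      run ρ c y                ≡⟨ run-untrack ρ c y ⟩
      c (untrack ρ y)          ∎)) ⟩
    track ρ (untrack ρ y)    ≡⟨ track-untrack ρ y ⟩
    y                        ∎

  run-resp : ∀ ρ {c c′} → c ≐ c′ → run ρ c ≐ run ρ c′
  run-resp ρ {c} {c′} c≐c′ w =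
    trans (run-untrack ρ c w) (trans (c≐c′ _) (sym (run-untrack ρ c′ w)))

  run-rename : ∀ ρ (g : Token → Token) c → run ρ (g ∘ c) ≐ g ∘ run ρ c
  run-rename ρ g c w = trans (run-untrack ρ (g ∘ c) w) (cong g (sym (run-untrack ρ c w)))

  swap-transposes : ∀ s c → Inj c → applySwap s c ≐ transpose (c (left s)) (c (right s)) ∘ c
  swap-transposes s c c-inj v with moveCase s v
  ... | atLeft v≡l m = begin
    applySwap s c v                          ≡⟨ applySwap-move s c v ⟩
    c (move s v)                             ≡⟨ cong c m ⟩
    c (right s)                              ≡⟨ sym (transpose-first (c (left s)) (c (right s))) ⟩
    transpose (c (left s)) (c (right s)) (c (left s)) ≡⟨ cong (λ u → transpose _ _ (c u)) (sym v≡l) ⟩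
    transpose (c (left s)) (c (right s)) (c v) ∎
  ... | atRight v≡r m = begin
    applySwap s c v                          ≡⟨ applySwap-move s c v ⟩
    c (move s v)                             ≡⟨ cong c m ⟩
    c (left s)                               ≡⟨ sym (transpose-second _ _ (left≢right s ∘ sym ∘ c-inj)) ⟩
    transpose (c (left s)) (c (right s)) (c (right s)) ≡⟨ cong (λ u → transpose _ _ (c u)) (sym v≡r) ⟩
    transpose (c (left s)) (c (right s)) (c v) ∎
  ... | elsewhere v≢l v≢r m = begin
    applySwap s c v                          ≡⟨ applySwap-move s c v ⟩
    c (move s v)                             ≡⟨ cong c m ⟩
    c v                                      ≡⟨ sym (transpose-other _ _ _ (v≢l ∘ c-inj) (v≢r ∘ c-inj)) ⟩
    transpose (c (left s)) (c (right s)) (c v) ∎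

  applySwap-left : ∀ s c → applySwap s c (left s) ≡ c (right s)
  applySwap-left s c = trans (applySwap-move s c (left s)) (cong c (move-left s))

  applySwap-right : ∀ s c → applySwap s c (right s) ≡ c (left s)
  applySwap-right s c = trans (applySwap-move s c (right s)) (cong c (move-right s))

  applySwap-moved : ∀ s c v → applySwap s c (move s v) ≡ c v
  applySwap-moved s c v = trans (applySwap-move s c (move s v)) (cong c (move-invol s v))

  -- Exchanging two tokens commutes with any swap sequence ρ: exchanging them by s
  -- before ρ has the same effect as exchanging them by e after ρ, provided ρ has
  -- brought them onto the endpoints of e (in the same orientation).
  exchange-commutes : ∀ ρ s e c → Inj c →
    run ρ c (left e) ≡ c (left s) → run ρ c (right e) ≡ c (right s) →
    run ρ (applySwap s c) ≐ applySwap e (run ρ c)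
  exchange-commutes ρ s e c c-inj onLeft onRight w = begin
    run ρ (applySwap s c) w                ≡⟨ run-resp ρ (swap-transposes s c c-inj) w ⟩
    run ρ (τ ∘ c) w                        ≡⟨ run-rename ρ τ c w ⟩
    τ (run ρ c w)                          ≡⟨ cong₂ (λ a b → transpose a b (run ρ c w)) (sym onLeft) (sym onRight) ⟩
    transpose (run ρ c (left e)) (run ρ c (right e)) (run ρ c w)
                                           ≡⟨ sym (swap-transposes e (run ρ c) (run-inj ρ c c-inj) w) ⟩
    applySwap e (run ρ c) w                ∎
    where τ = transpose (c (left s)) (c (right s))

  swap-back : ∀ ρ s e c → Inj c →
    run ρ (applySwap s c) (left e) ≡ c (right s) → run ρ (applySwap s c) (right e) ≡ c (left s) →
    run ρ c ≐ applySwap e (run ρ (applySwap s c))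
  swap-back ρ s e c c-inj onLeft onRight w = begin
    run ρ c w                ≡⟨ run-resp ρ (λ v → sym (applySwap-invol s c v)) w ⟩
    run ρ (applySwap s c₁) w ≡⟨ exchange-commutes ρ s e c₁ (run-inj (s ∷ []) c c-inj)
                                  (trans onLeft (sym (applySwap-left s c)))
                                  (trans onRight (sym (applySwap-right s c))) w ⟩
    applySwap e (run ρ c₁) w ∎
    where c₁ = applySwap s c

  -- Depth of a vertex: all leaves have depth k, the centre k+1 and path vertex v
  -- depth toℕ v + 1, so every edge goes exactly one level deeper from left to
  -- right.  A token is ranked by the depth of its target vertex.
  depth : Vertex → ℕ
  depth v = k ⊔ suc (toℕ v)

  depth-leaf : ∀ v → toℕ v < k → depth v ≡ k
  depth-leaf v v<k = ℕ.m≥n⇒m⊔n≡m v<k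

  depth-path : ∀ v → k ≤ toℕ v → depth v ≡ suc (toℕ v)
  depth-path v k≤v = ℕ.m≤n⇒m⊔n≡n (ℕ.m≤n⇒m≤1+n k≤v)

  k≤depth : ∀ v → k ≤ depth v
  k≤depth v = ℕ.m≤m⊔n k _

  depth-mono : ∀ u v → toℕ u ≤ toℕ v → depth u ≤ depth v
  depth-mono u v u≤v = ℕ.⊔-monoʳ-≤ k (s≤s u≤v)

  depth≡k⇒leaf : ∀ v → depth v ≡ k → toℕ v < k
  depth≡k⇒leaf v d≡k with k ℕ.≤? toℕ v
  ... | yes k≤v = ⊥-elim (ℕ.<-irrefl (sym d≡k) (subst (k <_) (sym (depth-path v k≤v)) (s≤s k≤v)))
  ... | no k≰v  = ℕ.≰⇒> k≰v

  k<depth⇒path : ∀ v → k < depth v → k ≤ toℕ v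
  k<depth⇒path v k<d with k ℕ.≤? toℕ v
  ... | yes k≤v = k≤v
  ... | no k≰v  = ⊥-elim (ℕ.<-irrefl (sym (depth-leaf v (ℕ.≰⇒> k≰v))) k<d)

  depth-strict : ∀ u v → k ≤ toℕ u → toℕ u < toℕ v → depth u < depth v
  depth-strict u v k≤u u<v = subst₂ _<_ (sym (depth-path u k≤u)) (sym (depth-path v k≤v)) (s≤s u<v)
    where k≤v = ℕ.<⇒≤ (ℕ.≤-<-trans k≤u u<v)

  depth-injective : ∀ v w → k < depth v → depth v ≡ depth w → v ≡ w
  depth-injective v w k<dv dv≡dw = toℕ-injective (ℕ.suc-injective (begin
    suc (toℕ v) ≡⟨ sym (depth-path v (k<depth⇒path v k<dv)) ⟩
    depth v     ≡⟨ dv≡dw ⟩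
    depth w     ≡⟨ depth-path w (k<depth⇒path w (subst (k <_) dv≡dw k<dv)) ⟩
    suc (toℕ w) ∎))

  depth-edge : ∀ s → depth (right s) ≡ suc (depth (left s))
  depth-edge (swap l r (inj₁ (l<k , r≡k))) = begin
    depth r     ≡⟨ depth-path r (ℕ.≤-reflexive (sym r≡k)) ⟩
    suc (toℕ r) ≡⟨ cong suc r≡k ⟩
    suc k       ≡⟨ cong suc (sym (depth-leaf l l<k)) ⟩
    suc (depth l) ∎
  depth-edge (swap l r (inj₂ (k≤l , r≡1+l))) = begin
    depth r     ≡⟨ depth-path r (subst (k ≤_) (sym r≡1+l) (ℕ.m≤n⇒m≤1+n k≤l)) ⟩
    suc (toℕ r) ≡⟨ cong suc r≡1+l ⟩
    suc (suc (toℕ l)) ≡⟨ cong suc (sym (depth-path l k≤l)) ⟩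
    suc (depth l) ∎

  star-right : ∀ s → ¬ k ≤ toℕ (left s) → toℕ (right s) ≡ k
  star-right (swap l r (inj₁ (_ , r≡k))) _   = r≡k
  star-right (swap l r (inj₂ (k≤l , _))) k≰l = ⊥-elim (k≰l k≤l)

  -- The ways in which two vertices x, y with depth x < depth y can lose their
  -- depth order in a single swap: either the swap exchanges them, or x is a leaf
  -- and y the centre (and the swap moves y onto another leaf).
  data FlipKind (s : Swap) (x y : Vertex) : Set where
    exchanged  : left s ≡ x → right s ≡ y → FlipKind s x y
    leafCentre : toℕ x < k → toℕ y ≡ k → FlipKind s x y

  flipStep : ∀ s x y → depth x < depth y → ¬ depth (move s x) < depth (move s y) → FlipKind s x y
  flipStep s x y x<y nlt = classify (moveCase s x) (moveCase s y)
    where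
      l<r : depth (left s) < depth (right s)
      l<r = subst (depth (left s) <_) (sym (depth-edge s)) (ℕ.n<1+n _)

      stuck : ∀ {x′ y′} → move s x ≡ x′ → move s y ≡ y′ → depth x′ < depth y′ → ⊥
      stuck refl refl = nlt

      lowered : y ≡ right s → move s x ≡ x → move s y ≡ left s → depth x ≡ depth (left s)
      lowered y≡r mx my = ℕ.≤-antisym
        (ℕ.≤-pred (subst (depth x <_) (depth-edge s) (subst (λ u → depth x < depth u) y≡r x<y)))
        (ℕ.≮⇒≥ (stuck mx my))

      -- Only leaves share a depth, so then x is a leaf and y the centre.
      yLowered : x ≢ left s → y ≡ right s → depth x ≡ depth (left s) → FlipKind s x y
      yLowered x≢l y≡r dx≡dl with k ℕ.≤? toℕ (left s)
      ... | yes k≤l = ⊥-elim (x≢l (sym (depth-injective (left s) x k<dl (sym dx≡dl))))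
        where
          k<dl : k < depth (left s)
          k<dl = subst (k <_) (sym (depth-path (left s) k≤l)) (s≤s k≤l)
      ... | no k≰l = leafCentre (depth≡k⇒leaf x (trans dx≡dl (depth-leaf (left s) (ℕ.≰⇒> k≰l))))
                                (trans (cong toℕ y≡r) (star-right s k≰l))

      classify : MoveCase s x → MoveCase s y → FlipKind s x y
      classify (atLeft x≡l _) (atLeft y≡l _) =
        ⊥-elim (ℕ.<-irrefl (cong depth (trans x≡l (sym y≡l))) x<y)
      classify (atLeft x≡l _) (atRight y≡r _) = exchanged (sym x≡l) (sym y≡r)
      classify (atLeft x≡l mx) (elsewhere _ y≢r my) =
        ⊥-elim (y≢r (sym (depth-injective (right s) y k<dr
                           (ℕ.≤-antisym dr≤dy (ℕ.≮⇒≥ (stuck mx my))))))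
        where
          k<dr : k < depth (right s)
          k<dr = subst (k <_) (sym (depth-edge s)) (s≤s (k≤depth (left s)))
          dr≤dy : depth (right s) ≤ depth y
          dr≤dy = subst (_≤ depth y) (sym (depth-edge s)) (subst (λ u → depth u < depth y) x≡l x<y)
      classify (atRight x≡r _) (atLeft y≡l _) =
        ⊥-elim (ℕ.<-asym (subst₂ (λ u v → depth u < depth v) x≡r y≡l x<y) l<r)
      classify (atRight x≡r _) (atRight y≡r _) =
        ⊥-elim (ℕ.<-irrefl (cong depth (trans x≡r (sym y≡r))) x<y)
      classify (atRight x≡r mx) (elsewhere _ _ my) =
        ⊥-elim (stuck mx my (ℕ.<-trans l<r (subst (λ u → depth u < depth y) x≡r x<y)))
      classify (elsewhere _ _ mx) (atLeft y≡l my) =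
        ⊥-elim (stuck mx my (ℕ.<-trans (subst (λ u → depth x < depth u) y≡l x<y) l<r))
      classify (elsewhere x≢l _ mx) (atRight y≡r my) = yLowered x≢l y≡r (lowered y≡r mx my)
      classify (elsewhere _ _ mx) (elsewhere _ _ my) = ⊥-elim (stuck mx my x<y)

  record Flip (ρ : List Swap) (x y : Vertex) : Set where
    constructor flipAt
    field
      pre   : List Swap
      step  : Swap
      post  : List Swap
      split : ρ ≡ pre ++ step ∷ post
      kind  : FlipKind step (track pre x) (track pre y)

  firstFlip : ∀ ρ x y → depth x < depth y → ¬ depth (track ρ x) < depth (track ρ y) → Flip ρ x y
  firstFlip []      x y x<y nlt = ⊥-elim (nlt x<y)
  firstFlip (s ∷ ρ) x y x<y nlt with depth (move s x) ℕ.<? depth (move s y)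
  ... | no nlt′ = flipAt [] s ρ refl (flipStep s x y x<y nlt′)
  ... | yes x<y′ with firstFlip ρ (move s x) (move s y) x<y′ nlt
  ...   | flipAt pre step post split kind = flipAt (s ∷ pre) step post (cong (s ∷_) split) kind

  StaysRight : Vertex → List Swap → Set
  StaysRight x []      = k < toℕ x
  StaysRight x (s ∷ ρ) = k < toℕ x × StaysRight (move s x) ρ

  staysRight-now : ∀ x ρ → StaysRight x ρ → k < toℕ x
  staysRight-now x []      k<x       = k<x
  staysRight-now x (s ∷ ρ) (k<x , _) = k<x

  staysRight-end : ∀ x ρ → StaysRight x ρ → k < toℕ (track ρ x)
  staysRight-end x []      k<x        = k<x
  staysRight-end x (s ∷ ρ) (_ , rest) = staysRight-end (move s x) ρ rest

  staysRight-drop : ∀ x ρ ρ′ → StaysRight x (ρ ++ ρ′) → StaysRight (track ρ x) ρ′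
  staysRight-drop x []      ρ′ stays        = stays
  staysRight-drop x (s ∷ ρ) ρ′ (_ , rest) = staysRight-drop (move s x) ρ ρ′ rest

  staysRight-take : ∀ x ρ ρ′ → StaysRight x (ρ ++ ρ′) → StaysRight x ρ
  staysRight-take x []      ρ′ stays        = staysRight-now x ρ′ stays
  staysRight-take x (s ∷ ρ) ρ′ (k<x , rest) = k<x , staysRight-take (move s x) ρ ρ′ rest

  staysRight-snoc : ∀ x ρ s → StaysRight x ρ → k < toℕ (move s (track ρ x)) →
                    StaysRight x (ρ ++ s ∷ [])
  staysRight-snoc x []       s k<x      k<x′ = k<x , k<x′
  staysRight-snoc x (s′ ∷ ρ) s (k<x , rest) k<x′ = k<x , staysRight-snoc (move s′ x) ρ s rest k<x′

  first-edge-of : ∀ s → k < toℕ (right s) → ¬ k < toℕ (left s) → OnFirstPathEdge s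
  first-edge-of s k<r k≮l = s-path , ℕ.≤-antisym (ℕ.≮⇒≥ k≮l) (proj₁ s-path)
    where s-path = path-by-right s k<r

  first-edge-right : ∀ s → OnFirstPathEdge s → toℕ (right s) ≡ suc k
  first-edge-right s ((_ , r≡1+l) , l≡k) = trans r≡1+l (cong suc l≡k)

  record Overtaking (ρ : List Swap) (x y : Vertex) : Set where
    constructor overtakingAt
    field
      pre     : List Swap
      step    : Swap
      post    : List Swap
      split   : ρ ≡ pre ++ step ∷ post
      onPath  : IsPathSwap step
      onLeft  : left step ≡ track pre x
      onRight : right step ≡ track pre y

  -- If one of two tokens stays right of the centre, they can only lose their
  -- depth order by overtaking each other on the path: a leaf-centre flip is
  -- impossible for a token beyond the centre.
  overtaking : ∀ ρ x y → depth x < depth y → ¬ depth (track ρ x) < depth (track ρ y) →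
               StaysRight x ρ ⊎ StaysRight y ρ → Overtaking ρ x y
  overtaking ρ x y x<y nlt stays with firstFlip ρ x y x<y nlt
  ... | flipAt pre step post split kind = classify kind (rightAtStep stays)
    where
      rightAtStep : StaysRight x ρ ⊎ StaysRight y ρ → k < toℕ (track pre x) ⊎ k < toℕ (track pre y)
      rightAtStep (inj₁ sx) = inj₁ (staysRight-now _ (step ∷ post)
                                (staysRight-drop x pre _ (subst (StaysRight x) split sx)))
      rightAtStep (inj₂ sy) = inj₂ (staysRight-now _ (step ∷ post)
                                (staysRight-drop y pre _ (subst (StaysRight y) split sy)))

      classify : FlipKind step (track pre x) (track pre y) →
                 k < toℕ (track pre x) ⊎ k < toℕ (track pre y) → Overtaking ρ x y
      classify (exchanged l≡ r≡) (inj₁ k<x) =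
        overtakingAt pre step post split
          (path-by-left step (subst (λ v → k ≤ toℕ v) (sym l≡) (ℕ.<⇒≤ k<x))) l≡ r≡
      classify (exchanged l≡ r≡) (inj₂ k<y) =
        overtakingAt pre step post split
          (path-by-right step (subst (λ v → k < toℕ v) (sym r≡) k<y)) l≡ r≡
      classify (leafCentre x<k _) (inj₁ k<x) = ⊥-elim (ℕ.<-asym x<k k<x)
      classify (leafCentre _ y≡k) (inj₂ k<y) = ⊥-elim (ℕ.<-irrefl (sym y≡k) k<y)

  length-insert : ∀ α ρ (s : Swap) β → length (α ++ (ρ ++ s ∷ β)) ≡ suc (length (α ++ (ρ ++ β)))
  length-insert α ρ s β = begin
    length (α ++ (ρ ++ s ∷ β))   ≡⟨ cong length (sym (++-assoc α ρ (s ∷ β))) ⟩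
    length ((α ++ ρ) ++ s ∷ β)   ≡⟨ length-++-sucʳ (α ++ ρ) s β ⟩
    suc (length ((α ++ ρ) ++ β)) ≡⟨ cong (suc ∘ length) (++-assoc α ρ β) ⟩
    suc (length (α ++ (ρ ++ β))) ∎

  pathSwaps-insert : ∀ α ρ s β → IsPathSwap s →
                     pathSwaps (α ++ (ρ ++ s ∷ β)) ≡ suc (pathSwaps (α ++ (ρ ++ β)))
  pathSwaps-insert α ρ s β s-path = begin
    length (φ (α ++ (ρ ++ s ∷ β)))  ≡⟨ cong (length ∘ φ) (sym (++-assoc α ρ (s ∷ β))) ⟩
    length (φ (xs ++ s ∷ β))        ≡⟨ cong length (filter-++ isPathSwap? xs (s ∷ β)) ⟩
    length (φ xs ++ φ (s ∷ β))      ≡⟨ cong (λ z → length (φ xs ++ z)) (filter-accept isPathSwap? s-path) ⟩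
    length (φ xs ++ s ∷ φ β)        ≡⟨ length-++-sucʳ (φ xs) s (φ β) ⟩
    suc (length (φ xs ++ φ β))      ≡⟨ cong (suc ∘ length) (sym (filter-++ isPathSwap? xs β)) ⟩
    suc (length (φ (xs ++ β)))      ≡⟨ cong (suc ∘ length ∘ φ) (++-assoc α ρ β) ⟩
    suc (length (φ (α ++ (ρ ++ β)))) ∎
    where
      φ = filter isPathSwap?
      xs = α ++ ρ

  pathSwaps-insert-star : ∀ α ρ s β → ¬ IsPathSwap s →
                          pathSwaps (α ++ (ρ ++ s ∷ β)) ≡ pathSwaps (α ++ (ρ ++ β))
  pathSwaps-insert-star α ρ s β s-star = begin
    length (φ (α ++ (ρ ++ s ∷ β)))  ≡⟨ cong (length ∘ φ) (sym (++-assoc α ρ (s ∷ β))) ⟩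
    length (φ (xs ++ s ∷ β))        ≡⟨ cong length (filter-++ isPathSwap? xs (s ∷ β)) ⟩
    length (φ xs ++ φ (s ∷ β))      ≡⟨ cong (λ z → length (φ xs ++ z)) (filter-reject isPathSwap? s-star) ⟩
    length (φ xs ++ φ β)            ≡⟨ cong length (sym (filter-++ isPathSwap? xs β)) ⟩
    length (φ (xs ++ β))            ≡⟨ cong (length ∘ φ) (++-assoc α ρ β) ⟩
    length (φ (α ++ (ρ ++ β)))      ∎
    where
      φ = filter isPathSwap?
      xs = α ++ ρ

-- Consequences of the P-optimality of σ for the (injective) instance f.  A
-- "time" of σ is a prefix α; the configuration at that time is cfg α.
module POpt (k n : ℕ) (f : Broom.Config k n) (f-inj : Injective _≡_ _≡_ f)
            (σ : List (Broom.Swap k n)) (popt : Broom.POptimal k n σ f) where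
  open Broom k n
  open Swaps k n

  cfg : List Swap → Config
  cfg α = run α f

  cfg-inj : ∀ α → Inj (cfg α)
  cfg-inj α = run-inj α f f-inj

  run-after : ∀ α ρ → σ ≡ α ++ ρ → run σ f ≐ run ρ (cfg α)
  run-after α ρ σ≡ = cong-app (trans (cong (λ τ → run τ f) σ≡) (run-++ α ρ f))

  sorted : Sorts σ f
  sorted = proj₁ (proj₁ popt)

  no-shorter : ∀ τ → run τ f ≐ run σ f → length τ < length σ → ⊥
  no-shorter τ same shorter =
    ℕ.<⇒≱ shorter (proj₂ (proj₁ popt) τ (λ x → trans (same x) (sorted x)))

  no-fewer-path-swaps : ∀ τ → run τ f ≐ run σ f → length τ ≡ length σ →
                        pathSwaps τ < pathSwaps σ → ⊥
  no-fewer-path-swaps τ same equal fewer = ℕ.<⇒≱ fewer (proj₂ popt τ τ-optimal)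
    where
      τ-optimal : Optimal τ f
      τ-optimal = (λ x → trans (same x) (sorted x)) ,
                  λ τ′ τ′-sorts → subst (_≤ length τ′) (sym equal) (proj₂ (proj₁ popt) τ′ τ′-sorts)

  -- Since σ sorts, every token ends on its own vertex: if the rest ρ of σ starts
  -- from c, the token on x ends on the vertex c x.
  final-position : ∀ ρ c → run σ f ≐ run ρ c → ∀ x → track ρ x ≡ c x
  final-position ρ c same x = begin
    track ρ x              ≡⟨ sym (sorted (track ρ x)) ⟩
    run σ f (track ρ x)    ≡⟨ same (track ρ x) ⟩
    run ρ c (track ρ x)    ≡⟨ run-track ρ c x ⟩
    c x                    ∎

  -- Surgery (i): two swaps exchanging the same two tokens back and forth cancel.
  no-swap-back : ∀ α s ρ e β → σ ≡ α ++ s ∷ (ρ ++ e ∷ β) →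
    run ρ (applySwap s (cfg α)) (left e) ≡ cfg α (right s) →
    run ρ (applySwap s (cfg α)) (right e) ≡ cfg α (left s) → ⊥
  no-swap-back α s ρ e β σ≡ onLeft onRight =
    no-shorter τ same (subst (length τ <_) (sym lengths) (ℕ.m≤n⇒m≤1+n (ℕ.n<1+n _)))
    where
      c = cfg α
      c₁ = applySwap s c
      τ = α ++ (ρ ++ β)
      same : run τ f ≐ run σ f
      same w = begin
        run τ f w                        ≡⟨ cong-app (run-++ α (ρ ++ β) f) w ⟩
        run (ρ ++ β) c w                 ≡⟨ cong-app (run-++ ρ β c) w ⟩
        run β (run ρ c) w                ≡⟨ run-resp β (swap-back ρ s e c (cfg-inj α) onLeft onRight) w ⟩
        run β (applySwap e (run ρ c₁)) w ≡⟨ sym (cong-app (run-++ ρ (e ∷ β) c₁) w) ⟩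
        run (ρ ++ e ∷ β) c₁ w            ≡⟨ sym (run-after α _ σ≡ w) ⟩
        run σ f w                        ∎
      lengths : length σ ≡ suc (suc (length τ))
      lengths = trans (cong length σ≡)
                      (trans (length-insert α [] s (ρ ++ e ∷ β)) (cong suc (length-insert α ρ e β)))

  -- Surgery (ii): a path swap whose two tokens later stand, exchanged, on a star
  -- edge {a, b} can be replaced by the star swap on {a, b} at that moment.
  no-postponable-path-swap : ∀ α s ρ β a b → StarEdge a b → σ ≡ α ++ s ∷ (ρ ++ β) → IsPathSwap s →
    run ρ (applySwap s (cfg α)) a ≡ cfg α (right s) →
    run ρ (applySwap s (cfg α)) b ≡ cfg α (left s) → ⊥
  no-postponable-path-swap α s ρ β a b ab σ≡ s-path onLeft onRight =
    no-fewer-path-swaps τ same lengths fewer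
    where
      e = swap a b (inj₁ ab)
      c = cfg α
      c₁ = applySwap s c
      τ = α ++ (ρ ++ e ∷ β)
      redone : applySwap e (run ρ c) ≐ run ρ c₁
      redone w = trans (run-resp (e ∷ []) (swap-back ρ s e c (cfg-inj α) onLeft onRight) w)
                       (applySwap-invol e (run ρ c₁) w)
      same : run τ f ≐ run σ f
      same w = begin
        run τ f w                       ≡⟨ cong-app (run-++ α (ρ ++ e ∷ β) f) w ⟩
        run (ρ ++ e ∷ β) c w            ≡⟨ cong-app (run-++ ρ (e ∷ β) c) w ⟩
        run β (applySwap e (run ρ c)) w ≡⟨ run-resp β redone w ⟩
        run β (run ρ c₁) w              ≡⟨ sym (cong-app (run-++ ρ β c₁) w) ⟩
        run (ρ ++ β) c₁ w               ≡⟨ sym (run-after α _ σ≡ w) ⟩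
        run σ f w                       ∎
      lengths : length τ ≡ length σ
      lengths = trans (length-insert α ρ e β) (sym (trans (cong length σ≡) (length-insert α [] s (ρ ++ β))))
      fewer : pathSwaps τ < pathSwaps σ
      fewer = subst₂ _<_ (sym (pathSwaps-insert-star α ρ e β (star-not-path e (proj₁ ab))))
                         (sym (trans (cong pathSwaps σ≡) (pathSwaps-insert α [] s (ρ ++ β) s-path)))
                         (ℕ.n<1+n _)

  -- Surgery (iii): a path swap whose two tokens stood earlier, in the same
  -- orientation, on a star edge {a, b} can be replaced by the star swap on {a, b}.
  no-anticipatable-path-swap : ∀ α ρ s β a b → StarEdge a b → σ ≡ α ++ (ρ ++ s ∷ β) → IsPathSwap s →
    run ρ (cfg α) (left s) ≡ cfg α a → run ρ (cfg α) (right s) ≡ cfg α b → ⊥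
  no-anticipatable-path-swap α ρ s β a b ab σ≡ s-path onLeft onRight =
    no-fewer-path-swaps τ same lengths fewer
    where
      e = swap a b (inj₁ ab)
      c = cfg α
      τ = α ++ e ∷ (ρ ++ β)
      same : run τ f ≐ run σ f
      same w = begin
        run τ f w                       ≡⟨ cong-app (run-++ α (e ∷ (ρ ++ β)) f) w ⟩
        run (ρ ++ β) (applySwap e c) w  ≡⟨ cong-app (run-++ ρ β (applySwap e c)) w ⟩
        run β (run ρ (applySwap e c)) w ≡⟨ run-resp β (exchange-commutes ρ e s c (cfg-inj α) onLeft onRight) w ⟩
        run β (applySwap s (run ρ c)) w ≡⟨ sym (cong-app (run-++ ρ (s ∷ β) c) w) ⟩
        run (ρ ++ s ∷ β) c w            ≡⟨ sym (run-after α _ σ≡ w) ⟩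
        run σ f w                       ∎
      lengths : length τ ≡ length σ
      lengths = trans (length-insert α [] e (ρ ++ β)) (sym (trans (cong length σ≡) (length-insert α ρ s β)))
      fewer : pathSwaps τ < pathSwaps σ
      fewer = subst₂ _<_ (sym (pathSwaps-insert-star α [] e (ρ ++ β) (star-not-path e (proj₁ ab))))
                         (sym (trans (cong pathSwaps σ≡) (pathSwaps-insert α ρ s β s-path)))
                         (ℕ.n<1+n _)

  -- Key lemma: in every path swap of σ the token with the deeper target moves
  -- right.  Otherwise the two tokens, which finish on their own vertices, must
  -- later regain their depth order; at the first moment they do, either they are
  -- swapped back (surgery (i)) or they sit on a star edge (surgery (ii)).
  deeper-moves-right₀ : ∀ α s ρ → σ ≡ α ++ s ∷ ρ → IsPathSwap s →
    depth (cfg α (right s)) < depth (cfg α (left s))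
  deeper-moves-right₀ α s ρ σ≡ s-path with depth (cfg α (right s)) ℕ.<? depth (cfg α (left s))
  ... | yes deeper = deeper
  ... | no shallower = ⊥-elim (refute (firstFlip ρ (left s) (right s) l<r reordered))
    where
      c = cfg α
      c₁ = applySwap s c
      ends : ∀ x → track ρ x ≡ c₁ x
      ends = final-position ρ c₁ (run-after α (s ∷ ρ) σ≡)
      l<r : depth (left s) < depth (right s)
      l<r = subst (depth (left s) <_) (sym (depth-edge s)) (ℕ.n<1+n _)
      reordered : ¬ depth (track ρ (left s)) < depth (track ρ (right s))
      reordered h = shallower (subst₂ (λ u v → depth u < depth v)
        (trans (ends (left s)) (applySwap-left s c)) (trans (ends (right s)) (applySwap-right s c)) h)
      refute : Flip ρ (left s) (right s) → ⊥
      refute (flipAt pre e post ρ≡ kind) = settle kind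
        where
          σ≡′ : σ ≡ α ++ s ∷ (pre ++ e ∷ post)
          σ≡′ = trans σ≡ (cong (λ z → α ++ s ∷ z) ρ≡)
          from-left : run pre c₁ (track pre (left s)) ≡ c (right s)
          from-left = trans (run-track pre c₁ (left s)) (applySwap-left s c)
          from-right : run pre c₁ (track pre (right s)) ≡ c (left s)
          from-right = trans (run-track pre c₁ (right s)) (applySwap-right s c)
          settle : FlipKind e (track pre (left s)) (track pre (right s)) → ⊥
          settle (exchanged l≡ r≡) = no-swap-back α s pre e post σ≡′
            (trans (cong (run pre c₁) l≡) from-left) (trans (cong (run pre c₁) r≡) from-right)
          settle (leafCentre x<k y≡k) =
            no-postponable-path-swap α s pre (e ∷ post) _ _ (x<k , y≡k) σ≡′ s-path from-left from-right

  deeper-moves-right : ∀ α ρ s β → σ ≡ α ++ (ρ ++ s ∷ β) → IsPathSwap s →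
    depth (run ρ (cfg α) (right s)) < depth (run ρ (cfg α) (left s))
  deeper-moves-right α ρ s β σ≡ s-path =
    subst (λ c → depth (c (right s)) < depth (c (left s))) (run-++ α ρ f)
      (deeper-moves-right₀ (α ++ ρ) s β (trans σ≡ (sym (++-assoc α ρ (s ∷ β)))) s-path)

  overtaking-order : ∀ α ρ₀ ρ β x y → σ ≡ α ++ (ρ₀ ++ (ρ ++ β)) → Overtaking ρ x y →
    depth (run ρ₀ (cfg α) y) < depth (run ρ₀ (cfg α) x)
  overtaking-order α ρ₀ ρ β x y σ≡ (overtakingAt pre s post ρ≡ s-path onLeft onRight) =
    subst₂ (λ u v → depth u < depth v) (token-at y onRight) (token-at x onLeft)
      (deeper-moves-right α (ρ₀ ++ pre) s (post ++ β) σ≡′ s-path)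
    where
      c₀ = run ρ₀ (cfg α)
      token-at : ∀ z {v} → v ≡ track pre z → run (ρ₀ ++ pre) (cfg α) v ≡ c₀ z
      token-at z {v} v≡ =
        trans (cong-app (run-++ ρ₀ pre (cfg α)) v) (trans (cong (run pre c₀) v≡) (run-track pre c₀ z))
      σ≡′ : σ ≡ α ++ ((ρ₀ ++ pre) ++ s ∷ (post ++ β))
      σ≡′ = trans σ≡ (cong (α ++_) (begin
        ρ₀ ++ (ρ ++ β)                 ≡⟨ cong (λ z → ρ₀ ++ (z ++ β)) ρ≡ ⟩
        ρ₀ ++ ((pre ++ s ∷ post) ++ β) ≡⟨ cong (ρ₀ ++_) (++-assoc pre (s ∷ post) β) ⟩
        ρ₀ ++ (pre ++ s ∷ (post ++ β)) ≡⟨ sym (++-assoc ρ₀ pre (s ∷ (post ++ β))) ⟩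
        (ρ₀ ++ pre) ++ s ∷ (post ++ β) ∎))

  -- Let the token t = cfg α (left si) cross the first path edge by si and stay
  -- right of the centre during ρ.  If afterwards a token Z ≠ t with a deeper
  -- target stands on the centre v, then Z stood on a leaf at time α: it cannot
  -- have come from the centre (that was t), from right si (by the key lemma it
  -- would be shallower than t), or from beyond (it would have overtaken t).
  arrives-from-leaf : ∀ α si ρ β v → σ ≡ α ++ si ∷ (ρ ++ β) → OnFirstPathEdge si →
    StaysRight (right si) ρ → toℕ v ≡ k →
    run ρ (applySwap si (cfg α)) v ≢ cfg α (left si) →
    depth (cfg α (left si)) < depth (run ρ (applySwap si (cfg α)) v) →
    Σ Vertex λ y → toℕ y < k × cfg α y ≡ run ρ (applySwap si (cfg α)) v
  arrives-from-leaf α si ρ β v σ≡ first stays v≡k Z≢t t<Z = classify (ℕ.<-cmp (toℕ y₀) k)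
    where
      c = cfg α
      c₁ = applySwap si c
      t = c (left si)
      Z = run ρ c₁ v
      y₁ = untrack ρ v
      y₀ = move si y₁
      Z-origin : c y₀ ≡ Z
      Z-origin = sym (trans (run-untrack ρ c₁ v) (applySwap-move si c y₁))
      l≡k : toℕ (left si) ≡ k
      l≡k = proj₂ first
      r≡1+k : toℕ (right si) ≡ suc k
      r≡1+k = first-edge-right si first

      from-right-end : y₀ ≡ right si → ⊥
      from-right-end y₀≡r = ℕ.<-asym t<Z
        (subst (λ u → depth u < depth t) (trans (cong c (sym y₀≡r)) Z-origin)
               (deeper-moves-right α [] si (ρ ++ β) σ≡ (proj₁ first)))

      from-beyond : suc k < toℕ y₀ → ⊥
      from-beyond 1+k<y₀ = ℕ.<-asym t<Z (subst₂ (λ u w → depth u < depth w) Z-after t-after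
                             (overtaking-order α (si ∷ []) ρ β (right si) y₁ σ≡
                               (overtaking ρ (right si) y₁ r<y₁ reordered (inj₁ stays))))
        where
          y₁≡y₀ : y₁ ≡ y₀
          y₁≡y₀ = trans (sym (move-invol si y₁))
            (move-elsewhere si y₀
              (λ h → ℕ.<-irrefl (sym (trans (cong toℕ h) l≡k)) (ℕ.<-trans (ℕ.n<1+n k) 1+k<y₀))
              (λ h → ℕ.<-irrefl (trans (sym r≡1+k) (cong toℕ (sym h))) 1+k<y₀))
          r<y₁ : depth (right si) < depth y₁
          r<y₁ = depth-strict (right si) y₁ (subst (k ≤_) (sym r≡1+k) (ℕ.n≤1+n k))
                              (subst₂ _<_ (sym r≡1+k) (cong toℕ (sym y₁≡y₀)) 1+k<y₀)
          reordered : ¬ depth (track ρ (right si)) < depth (track ρ y₁)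
          reordered h = ℕ.<-irrefl refl (ℕ.<-≤-trans (ℕ.<-trans beyond h) (ℕ.≤-reflexive centre))
            where
              beyond : depth v < depth (track ρ (right si))
              beyond = depth-strict v _ (ℕ.≤-reflexive (sym v≡k))
                         (subst (_< toℕ (track ρ (right si))) (sym v≡k) (staysRight-end (right si) ρ stays))
              centre : depth (track ρ y₁) ≡ depth v
              centre = cong depth (track-untrack ρ v)
          Z-after : c₁ y₁ ≡ Z
          Z-after = sym (run-untrack ρ c₁ v)
          t-after : c₁ (right si) ≡ t
          t-after = applySwap-right si c

      classify : Tri (toℕ y₀ < k) (toℕ y₀ ≡ k) (k < toℕ y₀) → Σ Vertex λ y → toℕ y < k × c y ≡ Z
      classify (tri< y₀<k _ _) = y₀ , y₀<k , Z-origin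
      classify (tri≈ _ y₀≡k _) =
        ⊥-elim (Z≢t (trans (sym Z-origin) (cong c (toℕ-injective (trans y₀≡k (sym l≡k))))))
      classify (tri> _ _ k<y₀) with ℕ.<-cmp (toℕ y₀) (suc k)
      ... | tri< y₀<1+k _ _ = ⊥-elim (ℕ.<-irrefl refl (ℕ.<-≤-trans y₀<1+k k<y₀))
      ... | tri≈ _ y₀≡1+k _ = ⊥-elim (from-right-end (toℕ-injective (trans y₀≡1+k (sym r≡1+k))))
      ... | tri> _ _ 1+k<y₀ = ⊥-elim (from-beyond 1+k<y₀)

  -- A token that crossed the first path edge from left to right by si and stayed
  -- right of the centre cannot cross back by sm: the token Z it meets on the
  -- centre came from a leaf, and exchanging Z with t there is cheaper (surgery (iii)).
  no-crossing-back : ∀ α si ρ sm β → σ ≡ α ++ si ∷ (ρ ++ sm ∷ β) →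
    OnFirstPathEdge si → OnFirstPathEdge sm → StaysRight (right si) ρ →
    run ρ (applySwap si (cfg α)) (right sm) ≡ cfg α (left si) → ⊥
  no-crossing-back α si ρ sm β σ≡ first-i first-m stays t-back =
    swap-at-leaf (arrives-from-leaf α si ρ (sm ∷ β) (left sm) σ≡ first-i stays (proj₂ first-m) Z≢t t<Z)
    where
      cₘ = run ρ (applySwap si (cfg α))
      Z≢t : cₘ (left sm) ≢ cfg α (left si)
      Z≢t eq = left≢right sm (run-inj ρ _ (run-inj (si ∷ []) (cfg α) (cfg-inj α)) (trans eq (sym t-back)))
      t<Z : depth (cfg α (left si)) < depth (cₘ (left sm))
      t<Z = subst (λ u → depth u < depth (cₘ (left sm))) t-back
                  (deeper-moves-right α (si ∷ ρ) sm β σ≡ (proj₁ first-m))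
      swap-at-leaf : Σ Vertex (λ y → toℕ y < k × cfg α y ≡ cₘ (left sm)) → ⊥
      swap-at-leaf (y₀ , y₀<k , Z-origin) =
        no-anticipatable-path-swap α (si ∷ ρ) sm β y₀ (left si) (y₀<k , proj₂ first-i) σ≡ (proj₁ first-m)
          (sym Z-origin) t-back

  -- A token that crosses the first path edge from left to right stays strictly
  -- right of the centre for the rest of σ: the first step taking it back to the
  -- centre would be a crossing back along the first path edge.
  crossed-stays-right : ∀ α si ρ → σ ≡ α ++ si ∷ ρ → OnFirstPathEdge si → StaysRight (right si) ρ
  crossed-stays-right α si ρ σ≡ first =
    extend [] ρ refl (ℕ.≤-reflexive (sym (first-edge-right si first)))
    where
      x = right si
      c₁ = applySwap si (cfg α)
      extend : ∀ done rest → ρ ≡ done ++ rest → StaysRight x done → StaysRight (track done x) rest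
      extend done []         _  stays = staysRight-end x done stays
      extend done (s ∷ rest) ρ≡ stays with k ℕ.<? toℕ (move s (track done x))
      ... | yes k<next = staysRight-end x done stays ,
              subst (λ v → StaysRight v rest) (track-++ done (s ∷ []) x)
                (extend (done ++ s ∷ []) rest (trans ρ≡ (sym (++-assoc done (s ∷ []) rest)))
                        (staysRight-snoc x done s stays k<next))
      ... | no k≮next = ⊥-elim (leaves (moveCase s p))
        where
          p = track done x
          k<p : k < toℕ p
          k<p = staysRight-end x done stays
          leaves : MoveCase s p → ⊥
          leaves (atLeft p≡l m) = k≮next (subst (λ v → k < toℕ v) (sym m)
                                   (ℕ.<-trans (subst (λ v → k < toℕ v) p≡l k<p) (left<right s)))
          leaves (atRight p≡r m) = no-crossing-back α si done s rest σ≡′ first s-first stays t-back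
            where
              σ≡′ : σ ≡ α ++ si ∷ (done ++ s ∷ rest)
              σ≡′ = trans σ≡ (cong (λ z → α ++ si ∷ z) ρ≡)
              s-first : OnFirstPathEdge s
              s-first = first-edge-of s (subst (λ v → k < toℕ v) p≡r k<p)
                                        (k≮next ∘ subst (λ v → k < toℕ v) (sym m))
              t-back : run done c₁ (right s) ≡ cfg α (left si)
              t-back = trans (cong (run done c₁) (sym p≡r))
                             (trans (run-track done c₁ x) (applySwap-right si (cfg α)))
          leaves (elsewhere _ _ m) = k≮next (subst (λ v → k < toℕ v) (sym m) k<p)

  -- Two distinct tokens t, t′ crossing the first path edge from left to right by
  -- si and later by sj: t′ has the shallower target.  Otherwise t′ came from a
  -- leaf; after sj it must overtake t on the path, and that path swap could be
  -- replaced by exchanging t′ and t on the star edge at time α (surgery (iii)).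
  crossings-decrease : ∀ α si ρ sj β → σ ≡ α ++ si ∷ (ρ ++ sj ∷ β) →
    OnFirstPathEdge si → OnFirstPathEdge sj →
    run ρ (applySwap si (cfg α)) (left sj) ≢ cfg α (left si) →
    depth (cfg α (left si)) < depth (run ρ (applySwap si (cfg α)) (left sj)) → ⊥
  crossings-decrease α si ρ sj β σ≡ first-i first-j t′≢t t<t′ =
    overtaken-later (arrives-from-leaf α si ρ (sj ∷ β) (left sj) σ≡ first-i
                       (staysRight-take x ρ (sj ∷ β) stays) (proj₂ first-j) t′≢t t<t′)
    where
      c = cfg α
      c₁ = applySwap si c
      c₂ = applySwap sj (run ρ c₁)
      x = right si
      t = c (left si)
      t′ = run ρ c₁ (left sj)
      stays : StaysRight x (ρ ++ sj ∷ β)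
      stays = crossed-stays-right α si (ρ ++ sj ∷ β) σ≡ first-i
      -- after sj the token t′ stands on right sj and t on xp, further right
      xp = move sj (track ρ x)
      xp-stays : StaysRight xp β
      xp-stays = proj₂ (staysRight-drop x ρ (sj ∷ β) stays)
      t-at : c₂ xp ≡ t
      t-at = trans (applySwap-moved sj (run ρ c₁) (track ρ x))
                   (trans (run-track ρ c₁ x) (applySwap-right si c))
      t′-at : c₂ (right sj) ≡ t′
      t′-at = applySwap-right sj (run ρ c₁)
      ends : ∀ v → track β v ≡ c₂ v
      ends = final-position β c₂ (λ w → trans (run-after α _ σ≡ w) (cong-app (run-++ ρ (sj ∷ β) c₁) w))
      r≡1+k : toℕ (right sj) ≡ suc k
      r≡1+k = first-edge-right sj first-j
      r<xp : depth (right sj) < depth xp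
      r<xp = depth-strict (right sj) xp (subst (k ≤_) (sym r≡1+k) (ℕ.n≤1+n k))
               (subst (_< toℕ xp) (sym r≡1+k) (ℕ.≤∧≢⇒< (staysRight-now xp β xp-stays) apart))
        where
          apart : suc k ≢ toℕ xp
          apart h = t′≢t (trans (sym t′-at) (trans (cong c₂ (toℕ-injective (trans r≡1+k h))) t-at))
      reordered : ¬ depth (track β (right sj)) < depth (track β xp)
      reordered h = ℕ.<-asym t<t′
        (subst₂ (λ u v → depth u < depth v) (trans (ends _) t′-at) (trans (ends _) t-at) h)
      overtaken-later : Σ Vertex (λ y → toℕ y < k × c y ≡ t′) → ⊥
      overtaken-later (y₀ , y₀<k , t′-origin)
        with overtaking β (right sj) xp r<xp reordered (inj₂ xp-stays)
      ... | overtakingAt pre s post β≡ s-path onLeft onRight =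
        no-anticipatable-path-swap α ρX s post y₀ (left si) (y₀<k , proj₂ first-i) σ≡′ s-path
          (trans (token-at _ onLeft) (trans t′-at (sym t′-origin))) (trans (token-at _ onRight) t-at)
        where
          ρX = si ∷ (ρ ++ sj ∷ pre)
          σ≡′ : σ ≡ α ++ (ρX ++ s ∷ post)
          σ≡′ = trans σ≡ (cong (λ z → α ++ si ∷ z)
                  (trans (cong (λ z → ρ ++ sj ∷ z) β≡) (sym (++-assoc ρ (sj ∷ pre) (s ∷ post)))))
          token-at : ∀ z {v} → v ≡ track pre z → run ρX c v ≡ c₂ z
          token-at z {v} v≡ = trans (cong-app (run-++ ρ (sj ∷ pre) c₁) v)
                                    (trans (cong (run pre c₂) v≡) (run-track pre c₂ z))

  deeper-moves-right-at : (i : Fin (length σ)) → IsPathSwap (lookup σ i) →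
    depth (before σ f i (right (lookup σ i))) < depth (before σ f i (left (lookup σ i)))
  deeper-moves-right-at i s-path with cut σ i
  ... | cutAt α ρ whole taken =
    subst (λ c → depth (c (right (lookup σ i))) < depth (c (left (lookup σ i))))
          (cong cfg (sym taken)) (deeper-moves-right₀ α (lookup σ i) ρ whole s-path)

  -- (1) Star tokens share the depth k, so a path swap never exchanges two of them.
  no-path-swap-of-star-tokens : (i : Fin (length σ)) → IsPathSwap (lookup σ i) →
    ¬ (StarToken (before σ f i (left (lookup σ i))) × StarToken (before σ f i (right (lookup σ i))))
  no-path-swap-of-star-tokens i s-path (star-l , star-r) =
    ℕ.<-irrefl (trans (depth-leaf _ star-r) (sym (depth-leaf _ star-l))) (deeper-moves-right-at i s-path)

  -- (2) Depth is monotone in the label, so the larger token moves right (this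
  -- holds for every path swap, whether or not it involves a path token).
  larger-token-moves-right : (i : Fin (length σ)) → IsPathSwap (lookup σ i) →
    toℕ (before σ f i (right (lookup σ i))) < toℕ (before σ f i (left (lookup σ i)))
  larger-token-moves-right i s-path =
    ℕ.≰⇒> (λ l≤r → ℕ.<⇒≱ (deeper-moves-right-at i s-path) (depth-mono _ _ l≤r))

  -- (3, in particular) A star token has the minimal depth k and cannot move right
  -- by a path swap.
  no-star-token-crosses : (t : Token) (i : Fin (length σ)) → CrossLR σ f t i → ¬ StarToken t
  no-star-token-crosses t i ((s-path , _) , on-left) star =
    ℕ.<⇒≱ (deeper-moves-right-at i s-path)
          (subst (_≤ depth (before σ f i (right (lookup σ i))))
                 (sym (trans (cong depth on-left) (depth-leaf t star))) (k≤depth _))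

  module AtPositions (i j : Fin (length σ)) (i<j : i <ᶠ j) where
    open Cut₂ (cut₂ σ i j i<j) public

    at-i : ∀ v → before σ f i v ≡ cfg front v
    at-i v = cong (λ τ → run τ f v) takenᵢ

    at-j : ∀ v → before σ f j v ≡ run middle (applySwap (lookup σ i) (cfg front)) v
    at-j v = trans (cong (λ τ → run τ f v) takenⱼ) (cong-app (run-++ front (lookup σ i ∷ middle) f) v)

  no-recrossing : (t : Token) (i j : Fin (length σ)) → i <ᶠ j → CrossLR σ f t i → ¬ CrossRL σ f t j
  no-recrossing t i j i<j (first-i , t-at-i) (first-j , t-at-j) =
    no-crossing-back front (lookup σ i) middle (lookup σ j) back whole first-i first-j
      (staysRight-take _ middle _ (crossed-stays-right front (lookup σ i) _ whole first-i))
      (trans (sym (at-j _)) (trans t-at-j (sym (trans (sym (at-i _)) t-at-i))))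
    where open AtPositions i j i<j

  crossings-in-decreasing-order : (t t′ : Token) (i j : Fin (length σ)) → i <ᶠ j → t ≢ t′ →
    PathToken t → PathToken t′ → CrossLR σ f t i → CrossLR σ f t′ j → toℕ t′ < toℕ t
  crossings-in-decreasing-order t t′ i j i<j t≢t′ path-t _ (first-i , t-at-i) (first-j , t′-at-j) =
    ℕ.≰⇒> λ t≤t′ → crossings-decrease front (lookup σ i) middle (lookup σ j) back whole first-i first-j
      (λ eq → t≢t′ (trans (sym t≡) (sym (trans (sym t′≡) eq))))
      (subst₂ (λ u v → depth u < depth v) (sym t≡) (sym t′≡)
        (depth-strict t t′ path-t (ℕ.≤∧≢⇒< t≤t′ (t≢t′ ∘ toℕ-injective))))
    where
      open AtPositions i j i<j
      t≡ : cfg front (left (lookup σ i)) ≡ t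
      t≡ = trans (sym (at-i _)) t-at-i
      t′≡ : run middle (applySwap (lookup σ i) (cfg front)) (left (lookup σ j)) ≡ t′
      t′≡ = trans (sym (at-j _)) t′-at-j

lemma7p4 : (k n : ℕ) → k < n →
    let open Broom k n in
    (f : Config) → Injective _≡_ _≡_ f →
    (σ : List Swap) → POptimal σ f →
    ((i : Fin (length σ)) → IsPathSwap (lookup σ i) →
    ¬ (StarToken (before σ f i (left (lookup σ i))) × StarToken (before σ f i (right (lookup σ i)))))
    × ((i : Fin (length σ)) → IsPathSwap (lookup σ i) →
    PathToken (before σ f i (left (lookup σ i))) ⊎ PathToken (before σ f i (right (lookup σ i))) →
    toℕ (before σ f i (right (lookup σ i))) < toℕ (before σ f i (left (lookup σ i))))
    × ((t : Token) (i j : Fin (length σ)) → i <ᶠ j → CrossLR σ f t i → ¬ CrossRL σ f t j)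
    × ((t : Token) (i : Fin (length σ)) → CrossLR σ f t i → ¬ StarToken t)
    × ((t t' : Token) (i j : Fin (length σ)) → i <ᶠ j → t ≢ t' →
    PathToken t → PathToken t' → CrossLR σ f t i → CrossLR σ f t' j → toℕ t' < toℕ t)
lemma7p4 k n _ f f-inj σ popt =
  no-path-swap-of-star-tokens ,
  (λ i s-path _ → larger-token-moves-right i s-path) ,
  no-recrossing ,
  no-star-token-crosses ,
  crossings-in-decreasing-order
  where open POpt k n f f-inj σ popt
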